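{- Let $G$ be a circulant graph of odd order $n$ with connection set $S=\{s_1,\dots,s_\Delta\}\subseteq\mathbb{Z}_n\setminus\{0\}$ (so $G$ is $\Delta$-regular with $\Delta=|S|$), viewing the $s_i$ as integers in $\{1,\dots,n-1\}$. Suppose that no $s_i$ is divisible by $\Delta+1$ and that no two distinct elements $s_i,s_k$ of $S$ are congruent modulo $\Delta+1$. Then $G$ is of type I, i.e. $\chi''(G)=\Delta+1$.
   Context: A circulant graph on $n$ vertices with connection set $S$ (a subset of $\mathbb{Z}_n\setminus\{0\}$ with $S=-S$) is the Cayley graph of the cyclic group $\mathbb{Z}_n$ with respect to $S$: vertices are $0,1,\dots,n-1$ and $x\sim y$ iff $x-y\in S$. A total coloring of a simple graph is an assignment of colors to vertices and edges such that adjacent vertices, adjacent edges, and an edge and its endpoints all receive different colors; $\chi''(G)$ is the minimum number of colors in a total coloring. A graph with maximum degree $\Delta$ is of type I if $\chi''(G)=\Delta+1$. The paper calls such a graph an "odd circulant graph"; here this is taken to mean a circulant graph on an odd number $n$ of vertices. -}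

module Defs where

open import Data.Nat using (ℕ; zero; suc; _+_; _*_; _∸_; NonZero; _%_; _<_)
open import Data.Empty using (⊥)
open import Data.Nat.DivMod using (_mod_)
open import Data.Fin using (Fin; toℕ)
open import Data.Fin.Subset using (Subset; _∈_; _∉_)
open import Data.Product using (_×_)
open import Relation.Binary.PropositionalEquality using (_≡_; _≢_)

negₙ : {n : ℕ} .{{_ : NonZero n}} → Fin n → Fin n
negₙ {n} x = (n ∸ toℕ x) mod n

subₙ : {n : ℕ} .{{_ : NonZero n}} → Fin n → Fin n → Fin n
subₙ {n} x y = (toℕ x + (n ∸ toℕ y)) mod n

IsConnectionSet : {n : ℕ} .{{_ : NonZero n}} → Subset n → Set
IsConnectionSet {n} S =
  ((x : Fin n) → x ∈ S → toℕ x ≢ 0) × ((x : Fin n) → x ∈ S → negₙ x ∈ S)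

Adj : {n : ℕ} .{{_ : NonZero n}} → Subset n → Fin n → Fin n → Set
Adj S x y = subₙ x y ∈ S

-- A total colouring of Cay(ℤ_n, S) with c colours (colours Fin c).
-- vc colours vertices; ec x y is the colour of the edge {x,y} (only its values
-- on adjacent pairs matter, and it must be symmetric there).
record TotalColoring {n : ℕ} .{{_ : NonZero n}} (S : Subset n) (c : ℕ) : Set where
  field
    vc : Fin n → Fin c
    ec : Fin n → Fin n → Fin c
    ec-sym   : ∀ x y → Adj S x y → ec x y ≡ ec y x
    vertices : ∀ x y → Adj S x y → vc x ≢ vc y
    incident : ∀ x y → Adj S x y → ec x y ≢ vc x
    edges    : ∀ x y z → Adj S x y → Adj S x z → y ≢ z → ec x y ≢ ec x z

TotalChromaticNumberIs : {n : ℕ} .{{_ : NonZero n}} → Subset n → ℕ → Set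
TotalChromaticNumberIs S c =
  TotalColoring S c × ((d : ℕ) → d < c → TotalColoring S d → ⊥)

-- Since no element of S is divisible by m = Δ + 1 and the elements of S have distinct
-- residues modulo m, these residues are exactly the Δ nonzero classes mod m. As S = -S,
-- the residue of n mod m must then be 0 (otherwise some s ≡ n, and -s = n - s ≡ 0), so
-- m divides n = 2k + 1 and k + 1 is an inverse of 2 modulo m.
-- Color the vertex x by x mod m and the edge {x, y} by (x + y)(k + 1) mod m: adjacent
-- vertices differ by an element of S, hence modulo m; the edges at x towards y and z
-- get equal colors only if y ≡ z, i.e. x - y ≡ x - z, which forces y = z; and the
-- edge {x, y} gets the color of x only if y ≡ x. Conversely, the Δ edges at a
-- vertex and the vertex itself need Δ + 1 distinct colors.
module Submission where

open import Defs
open import Data.Nat using (ℕ; suc; pred; _+_; _*_; _%_; _∸_; _≤_; _<_; NonZero; z≤n; s≤s)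
open import Data.Nat.Properties
open import Data.Nat.DivMod
open import Data.Nat.Divisibility using (_∣_; ∣-refl; ∣n⇒∣m*n; n∣m*n; m%n≡0⇒n∣m)
open import Data.Nat.Tactic.RingSolver using (solve-∀)
open import Data.Fin as F using (Fin; toℕ)
import Data.Fin.Properties as FP
open import Data.Fin.Subset using (Subset; _∈_; ∣_∣; _-_; ⊤; inside; outside)
open import Data.Fin.Subset.Properties using (∈⊤; x∈p∧x≢y⇒x∈p-y; x∈p⇒∣p-x∣<∣p∣; ∣⊤∣≡n)
open import Data.Vec.Base using ([]; _∷_; here; there)
open import Data.Product using (Σ; _×_; _,_)
open import Data.Empty using (⊥-elim)
open import Relation.Nullary using (¬_; yes; no; contradiction)
open import Relation.Binary.PropositionalEquality
  using (_≡_; _≢_; refl; sym; trans; cong; subst; module ≡-Reasoning)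

open ≡-Reasoning

injective⇒∣p∣≤∣q∣ : ∀ {n k} (p : Subset n) (q : Subset k) (f : Fin n → Fin k) →
  (∀ x → x ∈ p → f x ∈ q) → (∀ x y → x ∈ p → y ∈ p → f x ≡ f y → x ≡ y) →
  ∣ p ∣ ≤ ∣ q ∣
injective⇒∣p∣≤∣q∣ [] q f _ _ = z≤n
injective⇒∣p∣≤∣q∣ (outside ∷ p) q f into inj =
  injective⇒∣p∣≤∣q∣ p q (λ x → f (F.suc x)) (λ x x∈p → into (F.suc x) (there x∈p))
    (λ x y x∈p y∈p e → FP.suc-injective (inj _ _ (there x∈p) (there y∈p) e))
injective⇒∣p∣≤∣q∣ (inside ∷ p) q f into inj =
  ≤-trans (s≤s (injective⇒∣p∣≤∣q∣ p (q - f F.zero) (λ x → f (F.suc x)) into′ inj′))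
          (x∈p⇒∣p-x∣<∣p∣ (into F.zero here))
  where
  into′ : ∀ x → x ∈ p → f (F.suc x) ∈ q - f F.zero
  into′ x x∈p = x∈p∧x≢y⇒x∈p-y (into (F.suc x) (there x∈p))
                  (λ e → contradiction (inj _ _ (there x∈p) here e) λ ())
  inj′ : ∀ x y → x ∈ p → y ∈ p → f (F.suc x) ≡ f (F.suc y) → x ≡ y
  inj′ x y x∈p y∈p e = FP.suc-injective (inj _ _ (there x∈p) (there y∈p) e)

∣⊤-x∣<n : ∀ {n} (x : Fin n) → ∣ ⊤ - x ∣ < n
∣⊤-x∣<n {n} x = subst (∣ ⊤ - x ∣ <_) (∣⊤∣≡n n) (x∈p⇒∣p-x∣<∣p∣ (∈⊤ {x = x}))

module _ {d : ℕ} .{{_ : NonZero d}} where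

  %-+-congˡ : ∀ m n o → m % d ≡ n % d → (m + o) % d ≡ (n + o) % d
  %-+-congˡ m n o eq = begin
    (m + o) % d             ≡⟨ %-distribˡ-+ m o d ⟩
    (m % d + o % d) % d     ≡⟨ cong (λ r → (r + o % d) % d) eq ⟩
    (n % d + o % d) % d     ≡⟨ %-distribˡ-+ n o d ⟨
    (n + o) % d             ∎

  %-+-congʳ : ∀ m n o → n % d ≡ o % d → (m + n) % d ≡ (m + o) % d
  %-+-congʳ m n o eq = begin
    (m + n) % d ≡⟨ %-congˡ (+-comm m n) ⟩
    (n + m) % d ≡⟨ %-+-congˡ n o m eq ⟩
    (o + m) % d ≡⟨ %-congˡ (+-comm o m) ⟩
    (m + o) % d ∎

  %-*-congˡ : ∀ m n o → m % d ≡ n % d → (m * o) % d ≡ (n * o) % d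
  %-*-congˡ m n o eq = begin
    (m * o) % d             ≡⟨ %-distribˡ-* m o d ⟩
    ((m % d) * (o % d)) % d ≡⟨ cong (λ r → (r * (o % d)) % d) eq ⟩
    ((n % d) * (o % d)) % d ≡⟨ %-distribˡ-* n o d ⟨
    (n * o) % d             ∎

  %-+-cancelʳ : ∀ m n o → (m + o) % d ≡ (n + o) % d → m % d ≡ n % d
  %-+-cancelʳ m n o eq = begin
    m % d                    ≡⟨ add-o*pred-d m ⟨
    (m + o + o * pred d) % d ≡⟨ %-+-congˡ (m + o) (n + o) (o * pred d) eq ⟩
    (n + o + o * pred d) % d ≡⟨ add-o*pred-d n ⟩
    n % d                    ∎
    where
    add-o*pred-d : ∀ x → (x + o + o * pred d) % d ≡ x % d
    add-o*pred-d x = begin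
      (x + o + o * pred d) % d   ≡⟨ %-congˡ (+-assoc x o _) ⟩
      (x + (o + o * pred d)) % d ≡⟨ %-congˡ (cong (x +_) (*-suc o (pred d))) ⟨
      (x + o * suc (pred d)) % d ≡⟨ %-congˡ (cong (λ e → x + o * e) (suc-pred d)) ⟩
      (x + o * d) % d            ≡⟨ %-remove-+ʳ x (n∣m*n o) ⟩
      x % d                      ∎

  %-+-cancelˡ : ∀ m n o → (o + m) % d ≡ (o + n) % d → m % d ≡ n % d
  %-+-cancelˡ m n o eq = %-+-cancelʳ m n o
    (trans (%-congˡ (+-comm m o)) (trans eq (%-congˡ (+-comm o n))))

  toℕ-mod-injective : ∀ m n → m mod d ≡ n mod d → m % d ≡ n % d
  toℕ-mod-injective m n eq =
    trans (sym (FP.toℕ-fromℕ< _)) (trans (cong toℕ eq) (FP.toℕ-fromℕ< _))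

module _ {n : ℕ} .{{_ : NonZero n}} where

  toℕ-negₙ : (x : Fin n) → toℕ x ≢ 0 → toℕ (negₙ x) ≡ n ∸ toℕ x
  toℕ-negₙ x x≢0 = trans (FP.toℕ-fromℕ< _)
    (m<n⇒m%n≡m (∸-monoʳ-< {n} {toℕ x} {0} (n≢0⇒n>0 x≢0) (<⇒≤ (FP.toℕ<n x))))

  subₙ-+-% : ∀ {d} .{{_ : NonZero d}} → d ∣ n →
    (x y : Fin n) → (toℕ (subₙ x y) + toℕ y) % d ≡ toℕ x % d
  subₙ-+-% {d} d∣n x y = begin
    (toℕ (subₙ x y) + Y) % d      ≡⟨ %-congˡ (cong (_+ Y) (FP.toℕ-fromℕ< _)) ⟩
    ((X + (n ∸ Y)) % n + Y) % d   ≡⟨ %-+-congˡ _ _ Y (m∣n⇒o%n%m≡o%m d n (X + (n ∸ Y)) d∣n) ⟩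
    (X + (n ∸ Y) + Y) % d         ≡⟨ %-congˡ (+-assoc X (n ∸ Y) Y) ⟩
    (X + ((n ∸ Y) + Y)) % d       ≡⟨ %-congˡ (cong (X +_) (m∸n+n≡m (<⇒≤ (FP.toℕ<n y)))) ⟩
    (X + n) % d                   ≡⟨ %-remove-+ʳ X d∣n ⟩
    X % d                         ∎
    where
    X Y : ℕ
    X = toℕ x
    Y = toℕ y

  subₙ-cong-% : ∀ {d} .{{_ : NonZero d}} → d ∣ n → (x y z : Fin n) →
    toℕ y % d ≡ toℕ z % d → toℕ (subₙ x y) % d ≡ toℕ (subₙ x z) % d
  subₙ-cong-% {d} d∣n x y z y≡z = %-+-cancelʳ _ _ (toℕ y) (begin
    (toℕ (subₙ x y) + toℕ y) % d ≡⟨ subₙ-+-% d∣n x y ⟩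
    toℕ x % d                    ≡⟨ subₙ-+-% d∣n x z ⟨
    (toℕ (subₙ x z) + toℕ z) % d ≡⟨ %-+-congʳ _ _ _ y≡z ⟨
    (toℕ (subₙ x z) + toℕ y) % d ∎)

  subₙ-injectiveʳ : (x y z : Fin n) → subₙ x y ≡ subₙ x z → y ≡ z
  subₙ-injectiveʳ x y z eq = FP.toℕ-injective (begin
    toℕ y     ≡⟨ m<n⇒m%n≡m (FP.toℕ<n y) ⟨
    toℕ y % n ≡⟨ %-+-cancelˡ _ _ (toℕ (subₙ x y)) same-sum ⟩
    toℕ z % n ≡⟨ m<n⇒m%n≡m (FP.toℕ<n z) ⟩
    toℕ z     ∎)
    where
    same-sum : (toℕ (subₙ x y) + toℕ y) % n ≡ (toℕ (subₙ x y) + toℕ z) % n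
    same-sum = trans (subₙ-+-% ∣-refl x y)
      (trans (sym (subₙ-+-% ∣-refl x z)) (cong (λ w → (toℕ w + toℕ z) % n) (sym eq)))

  HasDistinctNonzeroResidues : Subset n → (d : ℕ) .{{_ : NonZero d}} → Set
  HasDistinctNonzeroResidues S d =
    ((s : Fin n) → s ∈ S → ¬ (d ∣ toℕ s)) ×
    ((s t : Fin n) → s ∈ S → t ∈ S → s ≢ t → toℕ s % d ≢ toℕ t % d)

  suc∣S∣∣n : ∀ {S} → IsConnectionSet S → HasDistinctNonzeroResidues S (suc ∣ S ∣) →
    suc ∣ S ∣ ∣ n
  suc∣S∣∣n {S} (0∉S , S≡-S) (nonzero , distinct) with n % suc ∣ S ∣ ≟ 0
  ... | yes n%m≡0 = m%n≡0⇒n∣m n _ n%m≡0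
  ... | no n%m≢0 = ⊥-elim (<-irrefl refl m<m)
    where
    m : ℕ
    m = suc ∣ S ∣
    r : Fin m
    r = n mod m
    r≢0 : r ≢ F.zero
    r≢0 e = n%m≢0 (trans (sym (FP.toℕ-fromℕ< _)) (cong toℕ e))
    residue-not-r : ∀ s → s ∈ S → toℕ s mod m ≢ r
    residue-not-r s s∈S e =
      nonzero (negₙ s) (S≡-S s s∈S) (m%n≡0⇒n∣m (toℕ (negₙ s)) m -s≡0)
      where
      -s≡0 : toℕ (negₙ s) % m ≡ 0
      -s≡0 = %-+-cancelʳ (toℕ (negₙ s)) 0 (toℕ s) (begin
        (toℕ (negₙ s) + toℕ s) % m ≡⟨ %-congˡ (cong (_+ toℕ s) (toℕ-negₙ s (0∉S s s∈S))) ⟩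
        (n ∸ toℕ s + toℕ s) % m    ≡⟨ %-congˡ (m∸n+n≡m (<⇒≤ (FP.toℕ<n s))) ⟩
        n % m                      ≡⟨ toℕ-mod-injective (toℕ s) n e ⟨
        toℕ s % m                  ∎)
    residue-avoids-0-r : ∀ s → s ∈ S → toℕ s mod m ∈ (⊤ - F.zero) - r
    residue-avoids-0-r s s∈S = x∈p∧x≢y⇒x∈p-y
      (x∈p∧x≢y⇒x∈p-y ∈⊤ λ e →
        nonzero s s∈S (m%n≡0⇒n∣m (toℕ s) m (toℕ-mod-injective (toℕ s) 0 e)))
      (residue-not-r s s∈S)
    residue-injective : ∀ s t → s ∈ S → t ∈ S → toℕ s mod m ≡ toℕ t mod m → s ≡ t
    residue-injective s t s∈S t∈S e with s FP.≟ t
    ... | yes s≡t = s≡t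
    ... | no s≢t =
      contradiction (toℕ-mod-injective (toℕ s) (toℕ t) e) (distinct s t s∈S t∈S s≢t)
    m<m : m < m
    m<m = ≤-<-trans
      (≤-trans (s≤s (injective⇒∣p∣≤∣q∣ S _ _ residue-avoids-0-r residue-injective))
               (x∈p⇒∣p-x∣<∣p∣ (x∈p∧x≢y⇒x∈p-y ∈⊤ r≢0)))
      (∣⊤-x∣<n F.zero)

module _ {n : ℕ} where

  subₙ-zero-negₙ : (x : Fin (suc n)) → toℕ x ≢ 0 → subₙ F.zero (negₙ x) ≡ x
  subₙ-zero-negₙ x x≢0 = FP.toℕ-injective (begin
    toℕ (subₙ F.zero (negₙ x))        ≡⟨ FP.toℕ-fromℕ< _ ⟩
    (suc n ∸ toℕ (negₙ x)) % suc n    ≡⟨ %-congˡ (cong (suc n ∸_) (toℕ-negₙ x x≢0)) ⟩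
    (suc n ∸ (suc n ∸ toℕ x)) % suc n ≡⟨ %-congˡ (m∸[m∸n]≡n (<⇒≤ (FP.toℕ<n x))) ⟩
    toℕ x % suc n                     ≡⟨ m<n⇒m%n≡m (FP.toℕ<n x) ⟩
    toℕ x                             ∎)

  totalColoring⇒∣S∣<c : ∀ {S c} → IsConnectionSet S → TotalColoring S c → ∣ S ∣ < c
  totalColoring⇒∣S∣<c {S} (0∉S , _) χ =
    ≤-trans (s≤s edge-colors-at-0) (∣⊤-x∣<n (vc F.zero))
    where
    open TotalColoring χ
    0-adj-neg : ∀ s → s ∈ S → Adj S F.zero (negₙ s)
    0-adj-neg s s∈S = subst (_∈ S) (sym (subₙ-zero-negₙ s (0∉S s s∈S))) s∈S
    edge-colors-at-0 : ∣ S ∣ ≤ ∣ ⊤ - vc F.zero ∣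
    edge-colors-at-0 = injective⇒∣p∣≤∣q∣ S (⊤ - vc F.zero) (λ s → ec F.zero (negₙ s))
      (λ s s∈S → x∈p∧x≢y⇒x∈p-y ∈⊤ (incident _ _ (0-adj-neg s s∈S)))
      injective
      where
      injective : ∀ s t → s ∈ S → t ∈ S → ec F.zero (negₙ s) ≡ ec F.zero (negₙ t) → s ≡ t
      injective s t s∈S t∈S eq with s FP.≟ t
      ... | yes s≡t = s≡t
      ... | no s≢t = ⊥-elim (edges _ _ _ (0-adj-neg s s∈S) (0-adj-neg t t∈S)
              (λ e → s≢t (begin
                s                        ≡⟨ subₙ-zero-negₙ s (0∉S s s∈S) ⟨
                subₙ F.zero (negₙ s)     ≡⟨ cong (subₙ F.zero) e ⟩
                subₙ F.zero (negₙ t)     ≡⟨ subₙ-zero-negₙ t (0∉S t t∈S) ⟩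
                t                        ∎)) eq)

module HalvingColoring (k : ℕ) {c : ℕ} .{{_ : NonZero c}} (c∣n : c ∣ suc (2 * k))
  {S : Subset (suc (2 * k))} (residues : HasDistinctNonzeroResidues S c) where

  open Σ residues renaming (proj₁ to nonzero; proj₂ to distinct)

  half : ℕ
  half = suc k

  x*half*2≡x : ∀ x → (x * half * 2) % c ≡ x % c
  x*half*2≡x x = begin
    (x * suc k * 2) % c       ≡⟨ %-congˡ (x*[1+k]*2≡x+x*[1+2k] x k) ⟩
    (x + x * suc (2 * k)) % c ≡⟨ %-remove-+ʳ x (∣n⇒∣m*n x c∣n) ⟩
    x % c                     ∎
    where
    x*[1+k]*2≡x+x*[1+2k] : ∀ x k → x * suc k * 2 ≡ x + x * suc (2 * k)
    x*[1+k]*2≡x+x*[1+2k] = solve-∀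

  *half-cancel : ∀ x y → (x * half) % c ≡ (y * half) % c → x % c ≡ y % c
  *half-cancel x y eq = begin
    x % c              ≡⟨ x*half*2≡x x ⟨
    (x * half * 2) % c ≡⟨ %-*-congˡ (x * half) (y * half) 2 eq ⟩
    (y * half * 2) % c ≡⟨ x*half*2≡x y ⟩
    y % c              ∎

  adjacent⇒residues-differ : ∀ x y → Adj S x y → toℕ x % c ≢ toℕ y % c
  adjacent⇒residues-differ x y x∼y x≡y = nonzero (subₙ x y) x∼y
    (m%n≡0⇒n∣m (toℕ (subₙ x y)) c
      (trans (%-+-cancelʳ (toℕ (subₙ x y)) 0 (toℕ y) (trans (subₙ-+-% c∣n x y) x≡y))
             (m*n%n≡0 0 c)))

  vertexColor : Fin (suc (2 * k)) → Fin c
  vertexColor x = toℕ x mod c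

  edgeColor : Fin (suc (2 * k)) → Fin (suc (2 * k)) → Fin c
  edgeColor x y = ((toℕ x + toℕ y) * half) mod c

  incident : ∀ x y → Adj S x y → edgeColor x y ≢ vertexColor x
  incident x y x∼y eq = adjacent⇒residues-differ x y x∼y (sym (%-+-cancelˡ Y X X (begin
    (X + Y) % c              ≡⟨ x*half*2≡x (X + Y) ⟨
    ((X + Y) * half * 2) % c ≡⟨ %-*-congˡ ((X + Y) * half) X 2 (toℕ-mod-injective _ X eq) ⟩
    (X * 2) % c              ≡⟨ %-congˡ (*-comm X 2) ⟩
    (X + (X + 0)) % c        ≡⟨ %-congˡ (cong (X +_) (+-identityʳ X)) ⟩
    (X + X) % c              ∎)))
    where
    X Y : ℕ
    X = toℕ x
    Y = toℕ y

  edges : ∀ x y z → Adj S x y → Adj S x z → y ≢ z → edgeColor x y ≢ edgeColor x z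
  edges x y z x∼y x∼z y≢z eq with subₙ x y FP.≟ subₙ x z
  ... | yes same = y≢z (subₙ-injectiveʳ x y z same)
  ... | no differ = distinct (subₙ x y) (subₙ x z) x∼y x∼z differ
          (subₙ-cong-% c∣n x y z y≡z)
    where
    y≡z : toℕ y % c ≡ toℕ z % c
    y≡z = %-+-cancelˡ (toℕ y) (toℕ z) (toℕ x)
      (*half-cancel (toℕ x + toℕ y) (toℕ x + toℕ z) (toℕ-mod-injective _ _ eq))

  coloring : TotalColoring S c
  coloring = record
    { vc = vertexColor
    ; ec = edgeColor
    ; ec-sym = λ x y _ → cong (λ t → (t * half) mod c) (+-comm (toℕ x) (toℕ y))
    ; vertices = λ x y x∼y eq → adjacent⇒residues-differ x y x∼y (toℕ-mod-injective _ _ eq)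
    ; incident = incident
    ; edges = edges
    }

theorem2p3 : (k : ℕ) (S : Subset (suc (2 * k))) → IsConnectionSet S →
    ((s : Fin (suc (2 * k))) → s ∈ S → ¬ (suc ∣ S ∣ ∣ toℕ s)) →
    ((s t : Fin (suc (2 * k))) → s ∈ S → t ∈ S → s ≢ t →
      toℕ s % suc ∣ S ∣ ≢ toℕ t % suc ∣ S ∣) →
    TotalChromaticNumberIs S (suc ∣ S ∣)
theorem2p3 k S isConnectionSet nonzero distinct =
    HalvingColoring.coloring k (suc∣S∣∣n isConnectionSet residues) residues
  , λ d d≤∣S∣ χ → <⇒≱ (totalColoring⇒∣S∣<c isConnectionSet χ) (≤-pred d≤∣S∣)
  where
  residues : HasDistinctNonzeroResidues S (suc ∣ S ∣)
  residues = nonzero , distinct
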